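{- Let $\Lambda=\{\lambda_0=0<\lambda_1<\dots\}$ be a numerical semigroup different from $\mathbb N$, with conductor $c$ and rank $k\ge1$, and let $u_{k-1}=\lambda_k-\lambda_{k-1}$. Then each of the elements $c,c+1,\dots,c+u_{k-1}-1$ is an order-$(k-1)$ seed of $\Lambda$.
   Context: A numerical semigroup is a cofinite submonoid of $\mathbb N$, with elements $\lambda_0=0<\lambda_1<\dots$. The genus $g$ is the number of gaps, the conductor $c$ is the largest gap plus one, and the rank is $k=c-g$, so that $\lambda_k=c$. For $p<k$, an element $\lambda_s\ge c$ of $\Lambda$ is an order-$p$ seed of $\Lambda$ if $\lambda_s+\lambda_p\neq\lambda_i+\lambda_j$ for all indices $p<i\le j<s$. -}

module Defs where

open import Data.Nat using (ℕ; zero; suc; _+_; _∸_; _≤_; _<_)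
open import Data.Product using (Σ; _×_; ∃)
open import Relation.Nullary using (¬_; Dec; yes; no)
open import Relation.Binary.PropositionalEquality using (_≡_; _≢_)

record NumericalSemigroup : Set₁ where
  field
    _∈Λ   : ℕ → Set
    dec   : (n : ℕ) → Dec (n ∈Λ)
    0∈    : 0 ∈Λ
    +-closed : ∀ {m n} → m ∈Λ → n ∈Λ → (m + n) ∈Λ
    cofinite : ∃ λ b → ∀ n → b ≤ n → n ∈Λ

open NumericalSemigroup public

IsEnumeration : NumericalSemigroup → (ℕ → ℕ) → Set
IsEnumeration Λ l =
  (∀ i → l i < l (suc i)) ×
  (∀ i → (Λ ∈Λ) (l i)) ×
  (∀ n → (Λ ∈Λ) n → ∃ λ i → l i ≡ n)

-- c is the conductor: all n ≥ c are in Λ, and c is least with this property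
-- (equivalently, c is the largest gap plus one, or 0 if there are no gaps).
IsConductor : NumericalSemigroup → ℕ → Set
IsConductor Λ c =
  (∀ n → c ≤ n → (Λ ∈Λ) n) ×
  (∀ m → (∀ n → m ≤ n → (Λ ∈Λ) n) → c ≤ m)

gapsBelow : NumericalSemigroup → ℕ → ℕ
gapsBelow Λ zero = 0
gapsBelow Λ (suc n) with dec Λ n
... | yes _ = gapsBelow Λ n
... | no  _ = suc (gapsBelow Λ n)

-- genus = number of gaps; all gaps lie below the conductor
genus : NumericalSemigroup → (c : ℕ) → ℕ
genus Λ c = gapsBelow Λ c

rank : NumericalSemigroup → (c : ℕ) → ℕ
rank Λ c = c ∸ genus Λ c

IsSeed : (l : ℕ → ℕ) (c k p x : ℕ) → Set
IsSeed l c k p x =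
  p < k ×
  Σ ℕ λ s → l s ≡ x × c ≤ l s ×
    (∀ i j → p < i → i ≤ j → j < s → l s + l p ≢ l i + l j)

{-# OPTIONS --safe #-}
module Submission where

-- The elements of Λ below the conductor c are exactly λ₀, …, λ_{k-1}, because there are
-- c − g of them; since everything from c on lies in Λ, λ_{k+t} = c + t. Now if
-- k − 1 < i ≤ j then λᵢ + λⱼ ≥ 2c, whereas for t < λ_k − λ_{k-1} we have
-- (c + t) + λ_{k-1} < c + λ_k = 2c, so c + t = λ_{k+t} is an order-(k−1) seed.

open import Defs
open import Data.Nat using (ℕ; zero; suc; _+_; _∸_; _≤_; _<_; _≤′_; ≤′-refl; ≤′-step; s≤s)
open import Data.Nat.Properties
open import Data.Sum using (inj₁; inj₂)
open import Data.Product using (∃; _,_; proj₁; proj₂)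
open import Function.Bundles using (_⇔_; mk⇔; Equivalence)
open import Relation.Nullary using (¬_; yes; no)
open import Relation.Binary.PropositionalEquality

membersBelow : NumericalSemigroup → ℕ → ℕ
membersBelow Λ zero = 0
membersBelow Λ (suc n) with dec Λ n
... | yes _ = suc (membersBelow Λ n)
... | no  _ = membersBelow Λ n

membersBelow+gapsBelow : ∀ Λ n → membersBelow Λ n + gapsBelow Λ n ≡ n
membersBelow+gapsBelow Λ zero = refl
membersBelow+gapsBelow Λ (suc n) with dec Λ n
... | yes _ = cong suc (membersBelow+gapsBelow Λ n)
... | no  _ = trans (+-suc (membersBelow Λ n) (gapsBelow Λ n))
                    (cong suc (membersBelow+gapsBelow Λ n))

rank≡membersBelow : ∀ Λ c → rank Λ c ≡ membersBelow Λ c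
rank≡membersBelow Λ c = begin
  c ∸ gapsBelow Λ c                                      ≡⟨ cong (_∸ gapsBelow Λ c) (sym (membersBelow+gapsBelow Λ c)) ⟩
  membersBelow Λ c + gapsBelow Λ c ∸ gapsBelow Λ c       ≡⟨ m+n∸n≡m (membersBelow Λ c) (gapsBelow Λ c) ⟩
  membersBelow Λ c                                       ∎
  where open ≡-Reasoning

module Increasing {l : ℕ → ℕ} (l-step : ∀ i → l i < l (suc i)) where

  strictMono′ : ∀ {i j} → suc i ≤′ j → l i < l j
  strictMono′ ≤′-refl       = l-step _
  strictMono′ (≤′-step i<j) = <-trans (strictMono′ i<j) (l-step _)

  strictMono : ∀ {i j} → i < j → l i < l j
  strictMono i<j = strictMono′ (≤⇒≤′ i<j)

  mono : ∀ {i j} → i ≤ j → l i ≤ l j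
  mono i≤j with m≤n⇒m<n∨m≡n i≤j
  ... | inj₁ i<j  = <⇒≤ (strictMono i<j)
  ... | inj₂ refl = ≤-refl

  reflects-≤ : ∀ {i j} → l i ≤ l j → i ≤ j
  reflects-≤ li≤lj = ≮⇒≥ (λ j<i → <⇒≱ (strictMono j<i) li≤lj)

  reflects-< : ∀ {i j} → l i < l j → i < j
  reflects-< li<lj = ≰⇒> (λ j≤i → <⇒≱ li<lj (mono j≤i))

conductorRange-isSeed : ∀ {l : ℕ → ℕ} → (∀ i → l i < l (suc i)) →
  ∀ {c k} → 1 ≤ k → (∀ t → l (k + t) ≡ c + t) →
  ∀ t → t < l k ∸ l (k ∸ 1) → IsSeed l c k (k ∸ 1) (c + t)
conductorRange-isSeed {l} l-step {c} {suc p} _ l[k+t]≡c+t t t<gap =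
  ≤-refl , suc p + t , l[k+t]≡c+t t , c≤l[k+t] , noDecomposition
  where
    open Increasing l-step
    open ≤-Reasoning

    l[k]≡c : l (suc p) ≡ c
    l[k]≡c = trans (cong l (sym (+-identityʳ (suc p)))) (trans (l[k+t]≡c+t 0) (+-identityʳ c))

    c≤l : ∀ {i} → suc p ≤ i → c ≤ l i
    c≤l k≤i = subst (_≤ _) l[k]≡c (mono k≤i)

    c≤l[k+t] : c ≤ l (suc p + t)
    c≤l[k+t] = c≤l (m≤m+n (suc p) t)

    t+l[p]<c : t + l p < c
    t+l[p]<c = begin-strict
      t + l p                      <⟨ +-monoˡ-< (l p) t<gap ⟩
      l (suc p) ∸ l p + l p        ≡⟨ m∸n+n≡m (<⇒≤ (l-step p)) ⟩
      l (suc p)                    ≡⟨ l[k]≡c ⟩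
      c                            ∎

    noDecomposition : ∀ i j → p < i → i ≤ j → j < suc p + t →
                      l (suc p + t) + l p ≢ l i + l j
    noDecomposition i j p<i i≤j _ eq = <-irrefl refl (begin-strict
      c + c                        ≤⟨ +-mono-≤ (c≤l p<i) (c≤l (≤-trans p<i i≤j)) ⟩
      l i + l j                    ≡⟨ sym eq ⟩
      l (suc p + t) + l p          ≡⟨ cong (_+ l p) (l[k+t]≡c+t t) ⟩
      c + t + l p                  ≡⟨ +-assoc c t (l p) ⟩
      c + (t + l p)                <⟨ +-monoʳ-< c t+l[p]<c ⟩
      c + c                        ∎)

module Enumeration (Λ : NumericalSemigroup) {l : ℕ → ℕ} (en : IsEnumeration Λ l) where

  open Increasing (proj₁ en)

  ∈Λ-enumerated : ∀ i → (Λ ∈Λ) (l i)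
  ∈Λ-enumerated = proj₁ (proj₂ en)

  enumerated-∈Λ : ∀ n → (Λ ∈Λ) n → ∃ λ i → l i ≡ n
  enumerated-∈Λ = proj₂ (proj₂ en)

  mutual
    <⇔<membersBelow : ∀ n i → l i < n ⇔ i < membersBelow Λ n
    <⇔<membersBelow zero i = mk⇔ (λ ()) (λ ())
    <⇔<membersBelow (suc n) i with dec Λ n
    ... | yes n∈Λ = mk⇔ to from
      where
        l[m]≡n : l (membersBelow Λ n) ≡ n
        l[m]≡n = l[membersBelow]≡ n n∈Λ

        to : l i < suc n → i < suc (membersBelow Λ n)
        to (s≤s l[i]≤n) = s≤s (reflects-≤ (subst (l i ≤_) (sym l[m]≡n) l[i]≤n))

        from : i < suc (membersBelow Λ n) → l i < suc n
        from (s≤s i≤m) = s≤s (subst (l i ≤_) l[m]≡n (mono i≤m))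
    ... | no n∉Λ = mk⇔ to from
      where
        to : l i < suc n → i < membersBelow Λ n
        to (s≤s l[i]≤n) = Equivalence.to (<⇔<membersBelow n i)
          (≤∧≢⇒< l[i]≤n (λ l[i]≡n → n∉Λ (subst (Λ ∈Λ) l[i]≡n (∈Λ-enumerated i))))

        from : i < membersBelow Λ n → l i < suc n
        from i<m = m<n⇒m<1+n (Equivalence.from (<⇔<membersBelow n i) i<m)

    l[membersBelow]≡ : ∀ n → (Λ ∈Λ) n → l (membersBelow Λ n) ≡ n
    l[membersBelow]≡ n n∈Λ with enumerated-∈Λ n n∈Λ
    ... | m , l[m]≡n = subst (λ i → l i ≡ n) (≤-antisym m≤mb mb≤m) l[m]≡n
      where
        mb≤m : membersBelow Λ n ≤ m
        mb≤m = ≮⇒≥ (λ m<mb → <-irrefl l[m]≡n (Equivalence.from (<⇔<membersBelow n m) m<mb))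

        n≤l[mb] : n ≤ l (membersBelow Λ n)
        n≤l[mb] = ≮⇒≥ (λ l[mb]<n → <-irrefl refl (Equivalence.to (<⇔<membersBelow n _) l[mb]<n))

        m≤mb : m ≤ membersBelow Λ n
        m≤mb = reflects-≤ (subst (_≤ l (membersBelow Λ n)) (sym l[m]≡n) n≤l[mb])

  l[suc]≡suc : ∀ i → (Λ ∈Λ) (suc (l i)) → l (suc i) ≡ suc (l i)
  l[suc]≡suc i suc[l[i]]∈Λ with enumerated-∈Λ _ suc[l[i]]∈Λ
  ... | m , l[m]≡1+l[i] = ≤-antisym l[1+i]≤1+l[i] (proj₁ en i)
    where
      i<m : i < m
      i<m = reflects-< (subst (l i <_) (sym l[m]≡1+l[i]) ≤-refl)

      l[1+i]≤1+l[i] : l (suc i) ≤ suc (l i)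
      l[1+i]≤1+l[i] = subst (l (suc i) ≤_) l[m]≡1+l[i] (mono i<m)

  l[membersBelow+]≡ : ∀ {c} → (∀ n → c ≤ n → (Λ ∈Λ) n) →
                     ∀ t → l (membersBelow Λ c + t) ≡ c + t
  l[membersBelow+]≡ {c} conductor zero = begin
    l (membersBelow Λ c + 0)   ≡⟨ cong l (+-identityʳ _) ⟩
    l (membersBelow Λ c)       ≡⟨ l[membersBelow]≡ c (conductor c ≤-refl) ⟩
    c                          ≡⟨ sym (+-identityʳ c) ⟩
    c + 0                      ∎
    where open ≡-Reasoning
  l[membersBelow+]≡ {c} conductor (suc t) = begin
    l (membersBelow Λ c + suc t)     ≡⟨ cong l (+-suc _ t) ⟩
    l (suc (membersBelow Λ c + t))   ≡⟨ l[suc]≡suc _ (subst (Λ ∈Λ) (cong suc (sym l[m+t]≡c+t)) c+t+1∈Λ) ⟩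
    suc (l (membersBelow Λ c + t))   ≡⟨ cong suc l[m+t]≡c+t ⟩
    suc (c + t)                      ≡⟨ sym (+-suc c t) ⟩
    c + suc t                        ∎
    where
      open ≡-Reasoning
      l[m+t]≡c+t : l (membersBelow Λ c + t) ≡ c + t
      l[m+t]≡c+t = l[membersBelow+]≡ conductor t
      c+t+1∈Λ : (Λ ∈Λ) (suc (c + t))
      c+t+1∈Λ = conductor _ (m≤n⇒m≤1+n (m≤m+n c t))

mainTheorem3 : (Λ : NumericalSemigroup) (l : ℕ → ℕ) (c : ℕ) →
    IsEnumeration Λ l → IsConductor Λ c →
    (∃ λ n → ¬ (Λ ∈Λ) n) →
    1 ≤ rank Λ c →
    ∀ t → t < l (rank Λ c) ∸ l (rank Λ c ∸ 1) →
    IsSeed l c (rank Λ c) (rank Λ c ∸ 1) (c + t)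
mainTheorem3 Λ l c en (conductor , _) _ 1≤k =
  conductorRange-isSeed (proj₁ en) 1≤k l[k+t]≡c+t
  where
    open Enumeration Λ en
    l[k+t]≡c+t : ∀ t → l (rank Λ c + t) ≡ c + t
    l[k+t]≡c+t t = subst (λ k → l (k + t) ≡ c + t) (sym (rank≡membersBelow Λ c))
                         (l[membersBelow+]≡ conductor t)
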